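{- Let $\mathcal{X}$ be an $n$-premaniplex and $(\mathcal{Y},\eta)$ an $(n,m)$-voltage operator. The graph $\mathcal{X}\rtimes_\eta\mathcal{Y}$ is connected if and only if $\mathcal{Y}$ is connected and $\eta(\Pi^{y_0}(\mathcal{Y}))$ acts transitively on the vertices of $\mathcal{X}$ for some vertex $y_0$ of $\mathcal{Y}$.
   Context: Graphs may have semiedges and parallel edges. An $n$-premaniplex is a graph whose darts are colored by $\{0,\dots,n-1\}$ (a dart and its inverse have the same color) such that every vertex is the starting point of exactly one dart of each color, and for $|i-j|\ge 2$ every path of length 4 alternating colors $i,j$ is closed. For a vertex $x$, ${}^i x$ denotes the dart of color $i$ starting at $x$, and $x^i$ its endpoint. The group $\mathrm{Mon}(\mathcal U^n)=\langle r_0,\dots,r_{n-1}\mid r_i^2=1,\ (r_ir_j)^2=1 \text{ for } |i-j|\ge2\rangle$ acts on the left on the vertex set of every $n$-premaniplex by $r_i x=x^i$. A voltage assignment $\eta$ with group $G$ assigns $\eta(d)\in G$ to each dart $d$ with $\eta(d^{ -1})=\eta(d)^{ -1}$; the voltage of a path $d_1\cdots d_k$ is $\eta(d_k)\cdots\eta(d_1)$. Paths are considered up to maniplex homotopy (inserting/deleting two consecutive darts of the same color, or swapping two consecutive colors $i,j$ with $|i-j|\ge2$); $\Pi^{y}(\mathcal Y)$ denotes the group of homotopy classes of closed paths based at $y$. An $(n,m)$-voltage operator is a pair $(\mathcal Y,\eta)$ with $\mathcal Y$ an $m$-premaniplex and $\eta$ a voltage assignment with group $\mathrm{Mon}(\mathcal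 U^n)$ such that every length-4 path alternating between colors $i,j$ with $|i-j|\ge2$ has trivial voltage (so $\eta$ is well defined on homotopy classes). For an $n$-premaniplex $\mathcal X$, $\mathcal X\rtimes_\eta\mathcal Y$ is the $m$-edge-colored graph on $V(\mathcal X)\times V(\mathcal Y)$ where for each color $i$ there is an edge of color $i$ joining $(x,y)$ and $(\eta({}^i y)x,\ y^i)$. -}

module Defs where

open import Data.Nat using (ℕ; _≤_; _+_)
open import Data.Fin using (Fin; toℕ)
open import Data.List using (List; []; _∷_; _++_)
open import Data.Product using (Σ; ∃; _×_; _,_)
open import Data.Sum using (_⊎_)
open import Relation.Binary.PropositionalEquality using (_≡_)
open import Relation.Binary.Construct.Closure.ReflexiveTransitive using (Star)

Far : ∀ {n} → Fin n → Fin n → Set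
Far i j = (2 + toℕ i ≤ toℕ j) ⊎ (2 + toℕ j ≤ toℕ i)

-- Since every vertex is the start of exactly one dart of
-- each colour, darts are the pairs (x , i); r i x = x^i is the endpoint of
-- the dart ^i x, and the inverse of ^i x is ^i (x^i) (same colour).
-- A semiedge is a dart with r i x ≡ x.
record Premaniplex (n : ℕ) : Set₁ where
  field
    V     : Set
    r     : Fin n → V → V
    invol : ∀ i x → r i (r i x) ≡ x
    comm  : ∀ i j → Far i j → ∀ x → r j (r i (r j (r i x))) ≡ x

open Premaniplex public

-- Mon(U^n) by its presentation: words in the generators r_0 .. r_(n-1)
-- (the list i₁ ∷ … ∷ iₖ stands for r_{i₁} ⋯ r_{iₖ}), modulo the least
-- congruence generated by the defining relations.
Word : ℕ → Set
Word n = List (Fin n)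

infix 4 _≈w_
data _≈w_ {n : ℕ} : Word n → Word n → Set where
  ≈refl  : ∀ {u} → u ≈w u
  ≈sym   : ∀ {u v} → u ≈w v → v ≈w u
  ≈trans : ∀ {u v w} → u ≈w v → v ≈w w → u ≈w w
  ≈cong  : ∀ {u u' v v'} → u ≈w u' → v ≈w v' → u ++ v ≈w u' ++ v'
  ≈inv   : ∀ i → i ∷ i ∷ [] ≈w []
  ≈far   : ∀ i j → Far i j → i ∷ j ∷ i ∷ j ∷ [] ≈w []

act : ∀ {n} (X : Premaniplex n) → Word n → V X → V X
act X []      x = x
act X (i ∷ w) x = r X i (act X w x)

-- a voltage assignment on an m-premaniplex with group Mon(U^n):
-- η y i is the voltage of the dart ^i y
Voltage : ∀ {m} (n : ℕ) (Y : Premaniplex m) → Set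
Voltage {m} n Y = V Y → Fin m → Word n

-- a path starting at y is determined by its sequence of colours
endpoint : ∀ {m} (Y : Premaniplex m) → V Y → List (Fin m) → V Y
endpoint Y y []       = y
endpoint Y y (c ∷ cs) = endpoint Y (r Y c y) cs

-- voltage of the path d₁ ⋯ dₖ is η(dₖ) ⋯ η(d₁)
pathVoltage : ∀ {n m} (Y : Premaniplex m) → Voltage n Y → V Y → List (Fin m) → Word n
pathVoltage Y η y []       = []
pathVoltage Y η y (c ∷ cs) = pathVoltage Y η (r Y c y) cs ++ η y c

record IsVoltageOperator {n m : ℕ} (Y : Premaniplex m) (η : Voltage n Y) : Set where
  field
    -- η(d⁻¹) = η(d)⁻¹, i.e. η(d⁻¹) η(d) = 1
    inverse  : ∀ i y → η (r Y i y) i ++ η y i ≈w []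
    trivial4 : ∀ i j → Far i j → ∀ y → pathVoltage Y η y (i ∷ j ∷ i ∷ j ∷ []) ≈w []

Connected : ∀ {k} {A : Set} → (Fin k → A → A) → Set
Connected {k} {A} f = ∀ u v → Star Adj u v
  where
  Adj : A → A → Set
  Adj a b = ∃ λ i → (b ≡ f i a) ⊎ (a ≡ f i b)

semidirect : ∀ {n m} (X : Premaniplex n) (Y : Premaniplex m) → Voltage n Y →
             Fin m → V X × V Y → V X × V Y
semidirect X Y η i (x , y) = act X (η y i) x , r Y i y

-- η(Π^{y₀}(Y)) acts transitively on V(X)
TransitiveAt : ∀ {n m} (X : Premaniplex n) (Y : Premaniplex m) → Voltage n Y → V Y → Set
TransitiveAt X Y η y₀ = ∀ x x' → ∃ λ cs →
  (endpoint Y y₀ cs ≡ y₀) × (act X (pathVoltage Y η y₀ cs) x ≡ x')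

{-# OPTIONS --safe #-}
module Submission where

-- Because η(d⁻¹) = η(d)⁻¹, each colour move of X ⋊_η Y is an involution, so
-- a walk is just a colour sequence cs, and following cs from (x , y) ends at
-- (η(cs) x , y·cs).  Projecting walks to Y gives connectivity of Y, and walks
-- from (x , y₀) to (x' , y₀) are closed paths at y₀ whose voltage sends x to
-- x'.  Conversely, lift paths from arbitrary vertices to the base vertex y₀
-- and join the fibre over y₀ by transitivity.

open import Defs
open import Data.Nat using (ℕ)
open import Data.Fin using (Fin)
open import Data.List using (List; []; _∷_; _++_)
open import Data.Product using (∃; _×_; _,_; proj₁; proj₂)
open import Data.Sum using (_⊎_; inj₁; inj₂)
open import Function.Bundles using (_⇔_; mk⇔)
open import Relation.Binary.PropositionalEquality
open import Relation.Binary.Construct.Closure.ReflexiveTransitive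
  using (Star; ε; _◅_; _◅◅_; reverse; gmap)

module _ {k : ℕ} {A : Set} (f : Fin k → A → A) where

  Adjacent : A → A → Set
  Adjacent a b = ∃ λ i → (b ≡ f i a) ⊎ (a ≡ f i b)

  Adjacent-sym : ∀ {a b} → Adjacent a b → Adjacent b a
  Adjacent-sym (i , inj₁ e) = i , inj₂ e
  Adjacent-sym (i , inj₂ e) = i , inj₁ e

  run : A → List (Fin k) → A
  run a []       = a
  run a (c ∷ cs) = run (f c a) cs

  walk : ∀ a cs → Star Adjacent a (run a cs)
  walk a []       = ε
  walk a (c ∷ cs) = (c , inj₁ refl) ◅ walk (f c a) cs

  walk-colours : (∀ i a → f i (f i a) ≡ a) →
                 ∀ {a b} → Star Adjacent a b → ∃ λ cs → run a cs ≡ b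
  walk-colours invol ε = [] , refl
  walk-colours invol ((i , inj₁ refl) ◅ p) with walk-colours invol p
  ... | cs , e = i ∷ cs , e
  walk-colours invol ((i , inj₂ refl) ◅ p) with walk-colours invol p
  ... | cs , e = i ∷ cs , trans (cong (λ a → run a cs) (invol i _)) e

Adjacent-map : ∀ {k : ℕ} {A B : Set} {f : Fin k → A → A} {h : Fin k → B → B}
               (g : A → B) → (∀ i a → g (f i a) ≡ h i (g a)) →
               ∀ {a b} → Adjacent f a b → Adjacent h (g a) (g b)
Adjacent-map g square (i , inj₁ refl) = i , inj₁ (square i _)
Adjacent-map g square (i , inj₂ refl) = i , inj₂ (square i _)

Far-sym : ∀ {n} {i j : Fin n} → Far i j → Far j i
Far-sym (inj₁ p) = inj₂ p
Far-sym (inj₂ p) = inj₁ p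

module _ {n : ℕ} (X : Premaniplex n) where

  act-++ : ∀ u v x → act X (u ++ v) x ≡ act X u (act X v x)
  act-++ []      v x = refl
  act-++ (i ∷ u) v x = cong (r X i) (act-++ u v x)

  act-resp-≈ : ∀ {u v} → u ≈w v → ∀ x → act X u x ≡ act X v x
  act-resp-≈ ≈refl          x = refl
  act-resp-≈ (≈sym p)       x = sym (act-resp-≈ p x)
  act-resp-≈ (≈trans p q)   x = trans (act-resp-≈ p x) (act-resp-≈ q x)
  act-resp-≈ (≈cong {u} {u'} {v} {v'} p q) x = begin
    act X (u ++ v) x       ≡⟨ act-++ u v x ⟩
    act X u (act X v x)    ≡⟨ act-resp-≈ p (act X v x) ⟩
    act X u' (act X v x)   ≡⟨ cong (act X u') (act-resp-≈ q x) ⟩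
    act X u' (act X v' x)  ≡⟨ act-++ u' v' x ⟨
    act X (u' ++ v') x     ∎
    where open ≡-Reasoning
  act-resp-≈ (≈inv i)       x = invol X i x
  act-resp-≈ (≈far i j far) x = comm X j i (Far-sym far) x

endpoint≡run : ∀ {m} (Y : Premaniplex m) y cs → endpoint Y y cs ≡ run (r Y) y cs
endpoint≡run Y y []       = refl
endpoint≡run Y y (c ∷ cs) = endpoint≡run Y (r Y c y) cs

module _ {n m : ℕ} (X : Premaniplex n) (Y : Premaniplex m) (η : Voltage n Y) where

  run-semidirect : ∀ x y cs → run (semidirect X Y η) (x , y) cs ≡
                   (act X (pathVoltage Y η y cs) x , endpoint Y y cs)
  run-semidirect x y []       = refl
  run-semidirect x y (c ∷ cs) =
    trans (run-semidirect (act X (η y c) x) (r Y c y) cs)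
          (cong (_, endpoint Y (r Y c y) cs) (sym (act-++ X (pathVoltage Y η (r Y c y) cs) (η y c) x)))

  lift-colours : ∀ x y cs → Star (Adjacent (semidirect X Y η)) (x , y)
                   (act X (pathVoltage Y η y cs) x , endpoint Y y cs)
  lift-colours x y cs = subst (Star _ (x , y)) (run-semidirect x y cs) (walk _ (x , y) cs)

  semidirect-involutive : IsVoltageOperator Y η →
                          ∀ i p → semidirect X Y η i (semidirect X Y η i p) ≡ p
  semidirect-involutive op i (x , y) = cong₂ _,_ voltage-cancels (invol Y i y)
    where
    open ≡-Reasoning
    voltage-cancels : act X (η (r Y i y) i) (act X (η y i) x) ≡ x
    voltage-cancels = begin
      act X (η (r Y i y) i) (act X (η y i) x) ≡⟨ act-++ X (η (r Y i y) i) (η y i) x ⟨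
      act X (η (r Y i y) i ++ η y i) x        ≡⟨ act-resp-≈ X (IsVoltageOperator.inverse op i y) x ⟩
      x                                       ∎

  lift-walk : ∀ {y y'} → Star (Adjacent (r Y)) y y' →
              ∀ x → ∃ λ x' → Star (Adjacent (semidirect X Y η)) (x , y) (x' , y')
  lift-walk {y} p x with walk-colours (r Y) (invol Y) p
  ... | cs , e = _ , subst (λ y' → Star _ (x , y) (act X (pathVoltage Y η y cs) x , y'))
                           (trans (endpoint≡run Y y cs) e) (lift-colours x y cs)

proposition3p9 : ∀ {n m : ℕ} (X : Premaniplex n) (Y : Premaniplex m) (η : Voltage n Y) →
    IsVoltageOperator Y η → V X → V Y →
    Connected (semidirect X Y η) ⇔ (Connected (r Y) × ∃ (λ y₀ → TransitiveAt X Y η y₀))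
proposition3p9 X Y η op x₀ y₀ = mk⇔ to from
  where
  to : Connected (semidirect X Y η) → Connected (r Y) × ∃ (TransitiveAt X Y η)
  to c = (λ y y' → gmap proj₂ (Adjacent-map proj₂ (λ _ _ → refl)) (c (x₀ , y) (x₀ , y')))
       , y₀ , transitive
    where
    transitive : TransitiveAt X Y η y₀
    transitive x x' with walk-colours _ (semidirect-involutive X Y η op) (c (x , y₀) (x' , y₀))
    ... | cs , e = cs , cong proj₂ ends , cong proj₁ ends
      where
      ends : (act X (pathVoltage Y η y₀ cs) x , endpoint Y y₀ cs) ≡ (x' , y₀)
      ends = trans (sym (run-semidirect X Y η x y₀ cs)) e

  from : Connected (r Y) × ∃ (TransitiveAt X Y η) → Connected (semidirect X Y η)
  from (cY , y₁ , tr) (x , y) (x' , y')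
    with lift-walk X Y η (cY y y₁) x | lift-walk X Y η (cY y' y₁) x'
  ... | a , to-a | b , to-b with tr a b
  ... | cs , closed , a↦b =
    to-a ◅◅ subst₂ (λ u w → Star _ (a , y₁) (u , w)) a↦b closed (lift-colours X Y η a y₁ cs)
         ◅◅ reverse (Adjacent-sym _) to-b
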